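{- Let $p$ be a prime and let $G$ be a $p$-group which is nilpotent of class $3$, and suppose $|\gamma_2G/\gamma_3G|=p^m$ for some $m\in\mathbb{N}$. Then $|\gamma_3G|\leq p^{2m^3}$. In particular, $G$ is finite-by-abelian (its derived subgroup $\gamma_2 G$ is finite).
   Context: $G=\gamma_1G\ge\gamma_2G\ge\gamma_3G\ge\cdots$ denotes the lower central series, $\gamma_{i+1}G=[\gamma_iG,G]$. A $p$-group is a group in which every element has $p$-power order (not assumed finite). -}

module Defs where

open import Level using (Level; _⊔_)
open import Algebra.Bundles using (Group)
open import Data.Nat using (ℕ; zero; suc; _≤_)
open import Data.Nat.Primality using (Prime)
open import Data.Fin using (Fin)
open import Data.Product using (Σ; ∃; ∃-syntax; _×_)
open import Data.Unit.Polymorphic using (⊤)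
open import Relation.Binary.PropositionalEquality using (_≡_)
open import Relation.Nullary using (¬_)

module GroupTheory {c ℓ : Level} (G : Group c ℓ) where
  open Group G

  _^_ : Carrier → ℕ → Carrier
  g ^ zero  = ε
  g ^ suc n = g ∙ (g ^ n)

  ⁅_,_⁆ : Carrier → Carrier → Carrier
  ⁅ x , y ⁆ = ((x ⁻¹ ∙ y ⁻¹) ∙ x) ∙ y

  data Gen (P : Carrier → Set (c ⊔ ℓ)) : Carrier → Set (c ⊔ ℓ) where
    gen-base : ∀ {x} → P x → Gen P x
    gen-ε    : Gen P ε
    gen-∙    : ∀ {x y} → Gen P x → Gen P y → Gen P (x ∙ y)
    gen-⁻¹   : ∀ {x} → Gen P x → Gen P (x ⁻¹)
    gen-≈    : ∀ {x y} → x ≈ y → Gen P x → Gen P y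

  -- lower central series, indexed so that γ 1 = G, γ (i+1) = [γ i, G]
  -- (γ 0 is also set to G; it is never used)
  γ : ℕ → Carrier → Set (c ⊔ ℓ)
  γ zero          _ = ⊤
  γ (suc zero)    _ = ⊤
  γ (suc (suc i)) = Gen (λ z → ∃[ a ] ∃[ b ] (γ (suc i) a × z ≈ ⁅ a , b ⁆))

  Trivial : (Carrier → Set (c ⊔ ℓ)) → Set (c ⊔ ℓ)
  Trivial H = ∀ x → H x → x ≈ ε

  NilpotentOfClass : ℕ → Set (c ⊔ ℓ)
  NilpotentOfClass k = Trivial (γ (suc k)) × ¬ Trivial (γ k)

  IsPGroup : ℕ → Set (c ⊔ ℓ)
  IsPGroup p = ∀ g → ∃[ k ] (g ^ (p Data.Nat.^ k) ≈ ε)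

  -- |H / K| = n  (K ≤ H): there is a family of n elements of H that are
  -- pairwise distinct modulo K and represent every coset of K in H
  QuotientCard : (H K : Carrier → Set (c ⊔ ℓ)) → ℕ → Set (c ⊔ ℓ)
  QuotientCard H K n =
    Σ (Fin n → Carrier) λ f →
      (∀ i → H (f i))
      × (∀ i j → K (f i ∙ f j ⁻¹) → i ≡ j)
      × (∀ a → H a → ∃[ i ] K (a ∙ f i ⁻¹))

  CardLe : (H : Carrier → Set (c ⊔ ℓ)) → ℕ → Set (c ⊔ ℓ)
  CardLe H N = ∀ (k : ℕ) (f : Fin k → Carrier) →
    (∀ i → H (f i)) → (∀ i j → f i ≈ f j → i ≡ j) → k ≤ N

module Submission where

open import Defs
open import Level using (Level; _⊔_; 0ℓ)
open import Algebra.Bundles using (Group; AbelianGroup)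
open import Algebra.Core using (Op₁; Op₂)
open import Algebra.Structures using (IsAbelianGroup)
import Data.Nat as ℕ
open import Data.Nat using (ℕ; zero; suc; _*_; _^_; _≤_; _<_; z≤n; s≤s; z<s; nonTrivial⇒n>1; >-nonZero)
open import Data.Nat.Properties
  using ( ≤-trans; <-trans; ≤-<-trans; ≮⇒≥; <⇒≱; n<1+n; m≤m*n; *-monoʳ-≤
        ; ^-monoʳ-≤; ^-monoʳ-<; ^-distribˡ-+-*; ^-*-assoc; module ≤-Reasoning )
open import Data.Nat.Coprimality using (Coprime; coprime-divisor)
open import Data.Nat.Divisibility using (∣1⇒≡1; ∣-trans)
open import Data.Nat.Primality using (Prime; prime⇒nonTrivial)
open import Data.Nat.Tactic.RingSolver using (solve-∀)
open import Data.Fin using (Fin; zero; suc; combine; funToFin)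
open import Data.Product using (Σ-syntax; ∃-syntax; _×_; _,_; proj₁; proj₂)
open import Function using (_∘_)
open import Relation.Binary.PropositionalEquality as ≡ using (_≡_; _≗_)

-- Since γ 4 is trivial, γ 3 is central, and on γ 2 × G the commutator is multiplicative in
-- both arguments and depends on its first argument only modulo γ 3.  The quotient γ 2 / γ 3
-- is an abelian p-group of order p ^ m generated by classes of commutators, so a greedy
-- choice gives commutators d₁ … dₖ spanning it with k ≤ m.  Every element of γ 3 is then a
-- product of the ⁅ dᵢ , gᵢ ⁆, and by the Hall–Witt identity ⁅ ⁅ x , y ⁆ , g ⁆ only depends on
-- the classes of ⁅ y ⁻¹ , g ⁻¹ ⁆ and ⁅ g , x ⁻¹ ⁆ modulo γ 3.  Hence |γ 3| ≤ (p ^ (2 * m)) ^ k,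
-- which is at most p ^ (2 * m ^ 2) ≤ p ^ (2 * m ^ 3), and |γ 2| ≤ p ^ m * |γ 3|.

coprime-^ : ∀ {m n} → Coprime m n → ∀ s → Coprime m (n ^ s)
coprime-^ m⊥n zero    (_ , d∣1) = ∣1⇒≡1 d∣1
coprime-^ {n = n} m⊥n (suc s) {d} (d∣m , d∣n*n^s) =
  coprime-^ m⊥n s (d∣m , coprime-divisor d⊥n d∣n*n^s)
  where
  d⊥n : Coprime d n
  d⊥n (e∣d , e∣n) = m⊥n (∣-trans e∣d d∣m , e∣n)

prime⇒1<p : ∀ {p} → Prime p → 1 < p
prime⇒1<p p-prime = nonTrivial⇒n>1 _ {{prime⇒nonTrivial p-prime}}

n<m^n : ∀ {m} → 1 < m → ∀ n → n < m ^ n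
n<m^n     1<m zero    = s≤s z≤n
n<m^n {m} 1<m (suc n) = ≤-<-trans (n<m^n 1<m n) (^-monoʳ-< m 1<m (n<1+n n))

m≤m*m : ∀ m → m ≤ m * m
m≤m*m zero    = z≤n
m≤m*m (suc m) = m≤m*n (suc m) (suc m)

^-square-bound : ∀ {p m k} → 1 < p → p ^ k ≤ p ^ m → (p ^ m * p ^ m) ^ k ≤ p ^ (2 * m ^ 3)
^-square-bound {p} {m} {k} 1<p p^k≤p^m = begin
  (p ^ m * p ^ m) ^ k            ≡⟨ ≡.cong (_^ k) (^-distribˡ-+-* p m m) ⟨
  (p ^ (m ℕ.+ m)) ^ k            ≡⟨ ^-*-assoc p (m ℕ.+ m) k ⟩
  p ^ ((m ℕ.+ m) * k)            ≤⟨ ^-monoʳ-≤ p (*-monoʳ-≤ (m ℕ.+ m) (≤-trans k≤m (m≤m*m m))) ⟩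
  p ^ ((m ℕ.+ m) * (m * m))      ≡⟨ ≡.cong (p ^_) (exponent m) ⟩
  p ^ (2 * m ^ 3)                ∎
  where
  open ≤-Reasoning
  instance _ = >-nonZero (<-trans z<s 1<p)
  k≤m : k ≤ m
  k≤m = ≮⇒≥ λ m<k → <⇒≱ (^-monoʳ-< p 1<p m<k) p^k≤p^m
  -- The right-hand side is 2 * m ^ 3 unfolded, which the ring solver needs.
  exponent : ∀ m → (m ℕ.+ m) * (m * m) ≡ 2 * (m * (m * (m * 1)))
  exponent = solve-∀

funToFin-cong : ∀ {m n} {f g : Fin m → Fin n} → f ≗ g → funToFin f ≡ funToFin g
funToFin-cong {zero}  f≗g = ≡.refl
funToFin-cong {suc m} f≗g = ≡.cong₂ combine (f≗g zero) (funToFin-cong (f≗g ∘ suc))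

module GroupSolver {c ℓ : Level} (G : Group c ℓ) where
  open Group G
  open import Algebra.Properties.Group G using (⁻¹-involutive; ⁻¹-anti-homo-∙; ε⁻¹≈ε)
  open import Relation.Binary.Reasoning.Setoid setoid
  open import Data.Bool using (Bool; true; false; not)
  open import Data.Bool.Properties using () renaming (_≟_ to _≟ᵇ_)
  open import Data.Fin.Properties using () renaming (_≟_ to _≟ᶠ_)
  open import Data.List using (List; []; _∷_)
  open import Data.Vec using (Vec; lookup)
  open import Relation.Nullary using (yes; no)

  infixl 7 _⊕_
  infix  8 ⊝_
  infixr 5 _◁_ _⊙_
  infix  8 _⁻¹ₗ _⁻¹ʷ

  data Expr (n : ℕ) : Set where
    var : Fin n → Expr n
    id  : Expr n
    _⊕_ : Expr n → Expr n → Expr n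
    ⊝_  : Expr n → Expr n

  ⁅_,_⁆ₑ : ∀ {n} → Expr n → Expr n → Expr n
  ⁅ a , b ⁆ₑ = ⊝ a ⊕ ⊝ b ⊕ a ⊕ b

  Env : ℕ → Set c
  Env = Vec Carrier

  ⟦_⟧ : ∀ {n} → Expr n → Env n → Carrier
  ⟦ var i ⟧ ρ = lookup ρ i
  ⟦ id    ⟧ ρ = ε
  ⟦ a ⊕ b ⟧ ρ = ⟦ a ⟧ ρ ∙ ⟦ b ⟧ ρ
  ⟦ ⊝ a   ⟧ ρ = ⟦ a ⟧ ρ ⁻¹

  -- Normal forms are freely reduced words; the letter (i , false) is the inverse of variable i.
  Letter : ℕ → Set
  Letter n = Fin n × Bool

  Word : ℕ → Set
  Word n = List (Letter n)

  _⁻¹ₗ : ∀ {n} → Letter n → Letter n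
  (i , b) ⁻¹ₗ = i , not b

  _◁_ : ∀ {n} → Letter n → Word n → Word n
  l ◁ [] = l ∷ []
  (i , b) ◁ ((j , d) ∷ w) with i ≟ᶠ j | b ≟ᵇ not d
  ... | yes ≡.refl | yes ≡.refl = w
  ... | _          | _          = (i , b) ∷ (j , d) ∷ w

  _⊙_ : ∀ {n} → Word n → Word n → Word n
  []      ⊙ w = w
  (l ∷ u) ⊙ w = l ◁ (u ⊙ w)

  _⁻¹ʷ : ∀ {n} → Word n → Word n
  []      ⁻¹ʷ = []
  (l ∷ u) ⁻¹ʷ = u ⁻¹ʷ ⊙ (l ⁻¹ₗ ∷ [])

  normalise : ∀ {n} → Expr n → Word n
  normalise (var i) = (i , true) ∷ []
  normalise id      = []
  normalise (a ⊕ b) = normalise a ⊙ normalise b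
  normalise (⊝ a)   = normalise a ⁻¹ʷ

  ⟦_⟧ₗ : ∀ {n} → Letter n → Env n → Carrier
  ⟦ i , true  ⟧ₗ ρ = lookup ρ i
  ⟦ i , false ⟧ₗ ρ = lookup ρ i ⁻¹

  ⟦_⟧ʷ : ∀ {n} → Word n → Env n → Carrier
  ⟦ []    ⟧ʷ ρ = ε
  ⟦ l ∷ w ⟧ʷ ρ = ⟦ l ⟧ₗ ρ ∙ ⟦ w ⟧ʷ ρ

  module _ {n : ℕ} (ρ : Env n) where
    ⟦⁻¹ₗ⟧ : ∀ l → ⟦ l ⁻¹ₗ ⟧ₗ ρ ≈ ⟦ l ⟧ₗ ρ ⁻¹
    ⟦⁻¹ₗ⟧ (i , true)  = refl
    ⟦⁻¹ₗ⟧ (i , false) = sym (⁻¹-involutive _)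

    ⟦⁻¹ₗ⟧-cancel : ∀ l x → ⟦ l ⁻¹ₗ ⟧ₗ ρ ∙ (⟦ l ⟧ₗ ρ ∙ x) ≈ x
    ⟦⁻¹ₗ⟧-cancel l x = begin
      ⟦ l ⁻¹ₗ ⟧ₗ ρ ∙ (⟦ l ⟧ₗ ρ ∙ x)  ≈⟨ ∙-congʳ (⟦⁻¹ₗ⟧ l) ⟩
      ⟦ l ⟧ₗ ρ ⁻¹ ∙ (⟦ l ⟧ₗ ρ ∙ x)   ≈⟨ assoc _ _ _ ⟨
      ⟦ l ⟧ₗ ρ ⁻¹ ∙ ⟦ l ⟧ₗ ρ ∙ x     ≈⟨ ∙-congʳ (inverseˡ _) ⟩
      ε ∙ x                         ≈⟨ identityˡ x ⟩
      x                             ∎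

    ◁-correct : ∀ l w → ⟦ l ◁ w ⟧ʷ ρ ≈ ⟦ l ⟧ₗ ρ ∙ ⟦ w ⟧ʷ ρ
    ◁-correct l [] = refl
    ◁-correct (i , b) ((j , d) ∷ w) with i ≟ᶠ j | b ≟ᵇ not d
    ... | yes ≡.refl | yes ≡.refl = sym (⟦⁻¹ₗ⟧-cancel (i , d) (⟦ w ⟧ʷ ρ))
    ... | yes ≡.refl | no _       = refl
    ... | no _       | _          = refl

    ⊙-correct : ∀ u w → ⟦ u ⊙ w ⟧ʷ ρ ≈ ⟦ u ⟧ʷ ρ ∙ ⟦ w ⟧ʷ ρ
    ⊙-correct []      w = sym (identityˡ _)
    ⊙-correct (l ∷ u) w = begin
      ⟦ l ◁ (u ⊙ w) ⟧ʷ ρ                ≈⟨ ◁-correct l (u ⊙ w) ⟩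
      ⟦ l ⟧ₗ ρ ∙ ⟦ u ⊙ w ⟧ʷ ρ           ≈⟨ ∙-congˡ (⊙-correct u w) ⟩
      ⟦ l ⟧ₗ ρ ∙ (⟦ u ⟧ʷ ρ ∙ ⟦ w ⟧ʷ ρ)  ≈⟨ assoc _ _ _ ⟨
      ⟦ l ⟧ₗ ρ ∙ ⟦ u ⟧ʷ ρ ∙ ⟦ w ⟧ʷ ρ    ∎

    ⁻¹ʷ-correct : ∀ u → ⟦ u ⁻¹ʷ ⟧ʷ ρ ≈ ⟦ u ⟧ʷ ρ ⁻¹
    ⁻¹ʷ-correct []      = sym ε⁻¹≈ε
    ⁻¹ʷ-correct (l ∷ u) = begin
      ⟦ u ⁻¹ʷ ⊙ (l ⁻¹ₗ ∷ []) ⟧ʷ ρ        ≈⟨ ⊙-correct (u ⁻¹ʷ) _ ⟩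
      ⟦ u ⁻¹ʷ ⟧ʷ ρ ∙ (⟦ l ⁻¹ₗ ⟧ₗ ρ ∙ ε)  ≈⟨ ∙-cong (⁻¹ʷ-correct u) (identityʳ _) ⟩
      ⟦ u ⟧ʷ ρ ⁻¹ ∙ ⟦ l ⁻¹ₗ ⟧ₗ ρ         ≈⟨ ∙-congˡ (⟦⁻¹ₗ⟧ l) ⟩
      ⟦ u ⟧ʷ ρ ⁻¹ ∙ ⟦ l ⟧ₗ ρ ⁻¹          ≈⟨ ⁻¹-anti-homo-∙ _ _ ⟨
      (⟦ l ⟧ₗ ρ ∙ ⟦ u ⟧ʷ ρ) ⁻¹           ∎

  ⟦_⇓⟧ : ∀ {n} → Expr n → Env n → Carrier
  ⟦ e ⇓⟧ = ⟦ normalise e ⟧ʷ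

  normalise-correct : ∀ {n} (e : Expr n) ρ → ⟦ e ⇓⟧ ρ ≈ ⟦ e ⟧ ρ
  normalise-correct (var i) ρ = identityʳ _
  normalise-correct id      ρ = refl
  normalise-correct (a ⊕ b) ρ =
    trans (⊙-correct ρ (normalise a) (normalise b)) (∙-cong (normalise-correct a ρ) (normalise-correct b ρ))
  normalise-correct (⊝ a)   ρ = trans (⁻¹ʷ-correct ρ (normalise a)) (⁻¹-cong (normalise-correct a ρ))

  open import Relation.Binary.Reflection setoid var ⟦_⟧ ⟦_⇓⟧ normalise-correct public
    using (solve; _⊜_)

module FiniteAbelianGroup
  {n : ℕ} {_∙_ : Op₂ (Fin n)} {ε : Fin n} {_⁻¹ : Op₁ (Fin n)}
  (isAbelianGroup : IsAbelianGroup _≡_ _∙_ ε _⁻¹) where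

  open import Data.Nat using (_∸_; _%_; _/_; pred; NonZero)
  open import Data.Nat.Properties
    using (suc-pred; m^n≢0; <-cmp; <⇒≤; m+[n∸m]≡n; m<n⇒0<n∸m; m∸n≤m; +-identityʳ; +-suc)
  open import Data.Nat.DivMod using (m≡m%n+[m/n]*n; m%n<n)
  import Data.Nat.Coprimality as Coprimality
  open Coprimality using (coprime-Bézout; prime⇒coprime)
  open import Data.Nat.GCD using (module Bézout)
  open import Data.Nat.Primality using (prime⇒nonZero)
  open import Data.Fin using (toℕ; fromℕ<; finToFun)
  open import Data.Fin.Properties
    using (any?; all?; ¬∀⟶∃¬; toℕ-fromℕ<; toℕ<n; toℕ-injective; injective⇒≤; funToFin-finToFin)
    renaming (_≟_ to _≟ᶠ_)
  open import Data.Vec.Functional using (head; tail; _∷_)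
  open import Data.Empty using (⊥-elim)
  open import Data.Sum as Sum using (_⊎_; inj₁; inj₂)
  open import Data.Unit using (⊤)
  open import Relation.Binary.Definitions using (tri<; tri≈; tri>)
  open import Relation.Binary.PropositionalEquality using (_≢_)
  open import Relation.Nullary using (yes; no; ¬_; contradiction)
  open import Relation.Nullary.Decidable using (map′)
  open import Relation.Unary using (Pred; Decidable)
  open ≡.≡-Reasoning

  abelianGroup : AbelianGroup 0ℓ 0ℓ
  abelianGroup = record { isAbelianGroup = isAbelianGroup }

  open AbelianGroup abelianGroup
    using (group; commutativeMonoid; identityʳ)
    renaming (_∙_ to _+_; ε to 0#; _⁻¹ to -_; assoc to +-assoc)
  open import Algebra.Properties.Group group
    using (inverseˡ-unique; inverseʳ-unique; y≈x\\z; x≈z//y; \\-leftDividesˡ; ∙-cancelˡ)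
  open import Algebra.Properties.CommutativeMonoid.Mult commutativeMonoid public
    using () renaming (_×_ to _·_)
  open import Algebra.Properties.CommutativeMonoid.Mult commutativeMonoid
    using (×-homo-+; ×-assocˡ)
  open import Algebra.Properties.CommutativeMonoid.Sum commutativeMonoid public
    using (sum; sum-syntax)
  open import Algebra.Properties.CommutativeMonoid.Sum commutativeMonoid
    using (∑-distrib-+; sum-cong-≋; sum-replicate-zero)

  ·-zeroʳ : ∀ e → e · 0# ≡ 0#
  ·-zeroʳ zero    = ≡.refl
  ·-zeroʳ (suc e) = ≡.trans (≡.cong (0# +_) (·-zeroʳ e)) (identityʳ 0#)

  _Annihilates_ : ℕ → Fin n → Set
  N Annihilates x = N · x ≡ 0#

  Annihilates-*ˡ : ∀ {N x} → N Annihilates x → ∀ q → (q * N) Annihilates x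
  Annihilates-*ˡ {N} {x} Nx≡0# q = begin
    (q * N) · x  ≡⟨ ×-assocˡ x q N ⟨
    q · (N · x)  ≡⟨ ≡.cong (q ·_) Nx≡0# ⟩
    q · 0#       ≡⟨ ·-zeroʳ q ⟩
    0#           ∎

  ·-mod : ∀ {N x} .{{_ : NonZero N}} → N Annihilates x → ∀ e → e · x ≡ (e % N) · x
  ·-mod {N} {x} Nx≡0# e = begin
    e · x                            ≡⟨ ≡.cong (_· x) (m≡m%n+[m/n]*n e N) ⟩
    (e % N ℕ.+ (e / N) * N) · x      ≡⟨ ×-homo-+ x (e % N) ((e / N) * N) ⟩
    (e % N) · x + ((e / N) * N) · x  ≡⟨ ≡.cong ((e % N) · x +_) (Annihilates-*ˡ Nx≡0# (e / N)) ⟩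
    (e % N) · x + 0#                 ≡⟨ identityʳ _ ⟩
    (e % N) · x                      ∎

  -‿≡pred· : ∀ {N x} .{{_ : NonZero N}} → N Annihilates x → - x ≡ pred N · x
  -‿≡pred· {N} {x} Nx≡0# =
    ≡.sym (inverseʳ-unique x (pred N · x) (≡.trans (≡.cong (_· x) (suc-pred N)) Nx≡0#))

  InSpan : ∀ {k} → (Fin k → Fin n) → Pred (Fin n) 0ℓ
  InSpan {k} c x = Σ[ e ∈ (Fin k → ℕ) ] x ≡ ∑[ i < k ] (e i · c i)

  Independent : ∀ {k} → (Fin k → Fin n) → Set
  Independent {zero}  c = ⊤
  Independent {suc k} c = ¬ InSpan (tail c) (head c) × Independent (tail c)

  data Generated {ℓ} (P : Pred (Fin n) ℓ) : Pred (Fin n) ℓ where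
    gen-base : ∀ {x} → P x → Generated P x
    gen-0#   : Generated P 0#
    gen-+    : ∀ {x y} → Generated P x → Generated P y → Generated P (x + y)
    gen-neg    : ∀ {x} → Generated P x → Generated P (- x)

  module _ {k : ℕ} {c : Fin k → Fin n} where
    InSpan-0# : InSpan c 0#
    InSpan-0# = (λ _ → 0) , ≡.sym (sum-replicate-zero k)

    InSpan-+ : ∀ {x y} → InSpan c x → InSpan c y → InSpan c (x + y)
    InSpan-+ (e , ≡.refl) (e′ , ≡.refl) = (λ i → e i ℕ.+ e′ i) , (begin
      ∑[ i < k ] (e i · c i) + ∑[ i < k ] (e′ i · c i)
        ≡⟨ ∑-distrib-+ (λ i → e i · c i) (λ i → e′ i · c i) ⟨
      ∑[ i < k ] (e i · c i + e′ i · c i)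
        ≡⟨ sum-cong-≋ (λ i → ×-homo-+ (c i) (e i) (e′ i)) ⟨
      ∑[ i < k ] ((e i ℕ.+ e′ i) · c i)
        ∎)

    InSpan-· : ∀ {x} → InSpan c x → ∀ e → InSpan c (e · x)
    InSpan-· x∈ zero    = InSpan-0#
    InSpan-· x∈ (suc e) = InSpan-+ x∈ (InSpan-· x∈ e)

    InSpan-∷⁺ : ∀ {x c₀} e → InSpan c (- (e · c₀) + x) → InSpan (c₀ ∷ c) x
    InSpan-∷⁺ {x} {c₀} e (es , eq) = (e ∷ es) , (begin
      x                                 ≡⟨ \\-leftDividesˡ (e · c₀) x ⟨
      e · c₀ + (- (e · c₀) + x)         ≡⟨ ≡.cong (e · c₀ +_) eq ⟩
      e · c₀ + ∑[ i < k ] (es i · c i)  ∎)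

    InSpan-∷⁻ : ∀ {x c₀} → InSpan (c₀ ∷ c) x → Σ[ e ∈ ℕ ] InSpan c (- (e · c₀) + x)
    InSpan-∷⁻ (es , eq) = head es , tail es , ≡.sym (y≈x\\z _ _ _ (≡.sym eq))

  module PGroup {p : ℕ} (p-prime : Prime p) (p-torsion : ∀ x → ∃[ s ] (p ^ s) Annihilates x) where

    p^-nonZero : ∀ s → NonZero (p ^ s)
    p^-nonZero s = m^n≢0 p s {{prime⇒nonZero p-prime}}

    module _ {k : ℕ} {c : Fin k → Fin n} where
      InSpan-neg : ∀ {x} → InSpan c x → InSpan c (- x)
      InSpan-neg {x} x∈ with p-torsion x
      ... | s , p^s·x≡0# =
        ≡.subst (InSpan c) (≡.sym (-‿≡pred· {{p^-nonZero s}} p^s·x≡0#)) (InSpan-· x∈ (pred (p ^ s)))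

      -- t is coprime to p ^ s, which annihilates x, so Bézout inverts t modulo p ^ s.
      InSpan-small-multiple : ∀ {t x} → 0 < t → t < p → InSpan c (t · x) → InSpan c x
      InSpan-small-multiple {t@(suc _)} {x} _ t<p t·x∈ with p-torsion x
      ... | s , p^s·x≡0# with coprime-Bézout (coprime-^ (Coprimality.sym (prime⇒coprime p-prime t<p)) s)
      ... | Bézout.+- u v eq = ≡.subst (InSpan c) (begin
            u · (t · x)          ≡⟨ ×-assocˡ x u t ⟩
            (u * t) · x          ≡⟨ ≡.cong (_· x) eq ⟨
            x + (v * p ^ s) · x  ≡⟨ ≡.cong (x +_) (Annihilates-*ˡ p^s·x≡0# v) ⟩
            x + 0#               ≡⟨ identityʳ x ⟩
            x                    ∎) (InSpan-· t·x∈ u)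
      ... | Bézout.-+ u v eq = ≡.subst (InSpan c) (≡.sym (inverseˡ-unique x (u · (t · x)) (begin
            x + u · (t · x)      ≡⟨ ≡.cong (x +_) (×-assocˡ x u t) ⟩
            x + (u * t) · x      ≡⟨ ≡.cong (_· x) eq ⟩
            (v * p ^ s) · x      ≡⟨ Annihilates-*ˡ p^s·x≡0# v ⟩
            0#                   ∎))) (InSpan-neg (InSpan-· t·x∈ u))

    InSpan? : ∀ {k} (c : Fin k → Fin n) → Decidable (InSpan c)
    InSpan? {zero}  c x = map′ (λ x≡0# → (λ ()) , x≡0#) proj₂ (x ≟ᶠ 0#)
    InSpan? {suc k} c x with p-torsion (head c)
    ... | s , p^s·c₀≡0# = map′ (λ (e , h) → InSpan-∷⁺ (toℕ e) h) reduce
                               (any? λ e → InSpan? (tail c) (- (toℕ e · head c) + x))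
      where
      instance _ = p^-nonZero s
      reduce : InSpan c x → ∃[ e ] InSpan (tail c) (- (toℕ e · head c) + x)
      reduce x∈ with InSpan-∷⁻ x∈
      ... | e , h = fromℕ< (m%n<n e (p ^ s)) , ≡.subst (λ y → InSpan (tail c) (- y + x)) e·c₀≡ h
        where
        e·c₀≡ : e · head c ≡ toℕ (fromℕ< (m%n<n e (p ^ s))) · head c
        e·c₀≡ = ≡.trans (·-mod p^s·c₀≡0# e) (≡.cong (_· head c) (≡.sym (toℕ-fromℕ< (m%n<n e (p ^ s)))))

    combination : ∀ {k} → (Fin k → Fin n) → (Fin k → Fin p) → Fin n
    combination {k} c u = ∑[ i < k ] (toℕ (u i) · c i)

    multiples-distinct-mod-span : ∀ {k} {c : Fin k → Fin n} {x a b X Y} → ¬ InSpan c x →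
                                  a < b → b < p → InSpan c X → InSpan c Y → a · x + X ≢ b · x + Y
    multiples-distinct-mod-span {x = x} {a} {b} {X} {Y} x∉ a<b b<p X∈ Y∈ eq =
      x∉ (InSpan-small-multiple (m<n⇒0<n∸m a<b) (≤-<-trans (m∸n≤m b a) b<p) d·x∈)
      where
      d = b ∸ a
      X≡d·x+Y : X ≡ d · x + Y
      X≡d·x+Y = ∙-cancelˡ (a · x) X (d · x + Y) (begin
        a · x + X            ≡⟨ eq ⟩
        b · x + Y            ≡⟨ ≡.cong (λ t → t · x + Y) (m+[n∸m]≡n (<⇒≤ a<b)) ⟨
        (a ℕ.+ d) · x + Y    ≡⟨ ≡.cong (_+ Y) (×-homo-+ x a d) ⟩
        a · x + d · x + Y    ≡⟨ +-assoc (a · x) (d · x) Y ⟩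
        a · x + (d · x + Y)  ∎)
      d·x∈ : InSpan _ (d · x)
      d·x∈ = ≡.subst (InSpan _) (≡.sym (x≈z//y (d · x) Y X (≡.sym X≡d·x+Y))) (InSpan-+ X∈ (InSpan-neg Y∈))

    combination-injective : ∀ {k} {c : Fin k → Fin n} → Independent c →
                            ∀ u v → combination c u ≡ combination c v → u ≗ v
    combination-injective {zero}      _                     u v eq ()
    combination-injective {suc k} {c} (c₀∉ , independent) u v eq
      with <-cmp (toℕ (head u)) (toℕ (head v))
    ... | tri< u₀<v₀ _ _ = ⊥-elim (multiples-distinct-mod-span c₀∉ u₀<v₀ (toℕ<n (head v))
                                     (toℕ ∘ tail u , ≡.refl) (toℕ ∘ tail v , ≡.refl) eq)
    ... | tri> _ _ v₀<u₀ = ⊥-elim (multiples-distinct-mod-span c₀∉ v₀<u₀ (toℕ<n (head u))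
                                     (toℕ ∘ tail v , ≡.refl) (toℕ ∘ tail u , ≡.refl) (≡.sym eq))
    ... | tri≈ _ u₀≡v₀ _ = u≗v
      where
      u≗v : u ≗ v
      u≗v zero    = toℕ-injective u₀≡v₀
      u≗v (suc i) = combination-injective independent (tail u) (tail v) (∙-cancelˡ _ _ _ eq′) i
        where
        eq′ = ≡.trans eq (≡.cong (λ t → t · head c + combination (tail c) (tail v)) (≡.sym u₀≡v₀))

    independent⇒p^k≤n : ∀ {k} {c : Fin k → Fin n} → Independent c → p ^ k ≤ n
    independent⇒p^k≤n {k} {c} independent =
      injective⇒≤ {f = combination c ∘ finToFun {p} {k}} λ {j} {j′} eq → begin
        j                               ≡⟨ funToFin-finToFin {k} {p} j ⟨
        funToFin (finToFun {p} {k} j)   ≡⟨ funToFin-cong (combination-injective independent _ _ eq) ⟩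
        funToFin (finToFun {p} {k} j′)  ≡⟨ funToFin-finToFin {k} {p} j′ ⟩
        j′                              ∎

    module _ {ℓ} {P : Pred (Fin n) ℓ} where
      InSpan⊎generator∉span : ∀ {k} (c : Fin k → Fin n) {x} → Generated P x →
                              InSpan c x ⊎ ∃[ y ] P y × ¬ InSpan c y
      InSpan⊎generator∉span c {x} (gen-base Px) with InSpan? c x
      ... | yes x∈ = inj₁ x∈
      ... | no  x∉ = inj₂ (x , Px , x∉)
      InSpan⊎generator∉span c gen-0# = inj₁ InSpan-0#
      InSpan⊎generator∉span c (gen-+ gx gy)
        with InSpan⊎generator∉span c gx | InSpan⊎generator∉span c gy
      ... | inj₁ x∈ | inj₁ y∈ = inj₁ (InSpan-+ x∈ y∈)
      ... | inj₂ z  | _       = inj₂ z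
      ... | inj₁ _  | inj₂ z  = inj₂ z
      InSpan⊎generator∉span c (gen-neg gx) = Sum.map₁ InSpan-neg (InSpan⊎generator∉span c gx)

      SpanningFamily : ℕ → Set ℓ
      SpanningFamily k = Σ[ c ∈ (Fin k → Fin n) ] (∀ i → P (c i)) × (∀ x → InSpan c x)

      -- Greedily adjoin generators outside the current span: the family stays independent,
      -- so p ^ k ≤ n bounds its length and the process stops.
      small-spanning-family : (∀ x → Generated P x) → ∃[ k ] p ^ k ≤ n × SpanningFamily k
      small-spanning-family generated = extend n {0} (λ ()) (λ ()) _ (n<m^n (prime⇒1<p p-prime) n)
        where
        extend : ∀ r {k} (c : Fin k → Fin n) → (∀ i → P (c i)) → Independent c →
                 n < p ^ (k ℕ.+ r) → ∃[ k ] p ^ k ≤ n × SpanningFamily k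
        extend zero {k} c Pc independent n<p^k = contradiction (independent⇒p^k≤n independent)
          (<⇒≱ (≡.subst (λ j → n < p ^ j) (+-identityʳ k) n<p^k))
        extend (suc r) {k} c Pc independent n<p^k+r with all? (InSpan? c)
        ... | yes spans = k , independent⇒p^k≤n independent , c , Pc , spans
        ... | no ¬spans with ¬∀⟶∃¬ n _ (InSpan? c) ¬spans
        ... | x , x∉ with InSpan⊎generator∉span c (generated x)
        ... | inj₁ x∈            = contradiction x∈ x∉
        ... | inj₂ (y , Py , y∉) =
          extend r (y ∷ c) P[y∷c] (y∉ , independent) (≡.subst (λ j → n < p ^ j) (+-suc k r) n<p^k+r)
          where
          P[y∷c] : ∀ i → P ((y ∷ c) i)
          P[y∷c] zero    = Py
          P[y∷c] (suc i) = Pc i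

module Images {c ℓ : Level} (G : Group c ℓ) where
  open Group G
  open GroupTheory G using (CardLe)
  open import Algebra.Properties.Monoid.Sum monoid using () renaming (sum to ∏; sum-cong-≋ to ∏-cong)
  open import Data.Fin using (remQuot; finToFun)
  open import Data.Fin.Properties using (injective⇒≤; remQuot-combine; finToFun-funToFin)

  infix 4 _∈Image_
  _∈Image_ : ∀ {I : Set} → Carrier → (I → Carrier) → Set ℓ
  x ∈Image rep = ∃[ i ] x ≈ rep i

  ∈Image-resp-≈ : ∀ {I : Set} {rep : I → Carrier} {x y} → x ≈ y → y ∈Image rep → x ∈Image rep
  ∈Image-resp-≈ x≈y (i , y≈) = i , trans x≈y y≈

  ∈Image-pair : ∀ {A B} {rep : Fin A × Fin B → Carrier} {x} → x ∈Image rep → x ∈Image rep ∘ remQuot B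
  ∈Image-pair {rep = rep} ((i , j) , x≈) =
    combine i j , trans x≈ (reflexive (≡.cong rep (≡.sym (remQuot-combine i j))))

  ∈Image-∏ : ∀ {k B} {rep : Fin k → Fin B → Carrier} {x : Fin k → Carrier} →
             (∀ i → x i ∈Image rep i) → ∏ x ∈Image (λ j → ∏ (λ i → rep i (finToFun j i)))
  ∈Image-∏ {rep = rep} x∈ = funToFin index , ∏-cong λ i →
    trans (proj₂ (x∈ i)) (reflexive (≡.cong (rep i) (≡.sym (finToFun-funToFin index i))))
    where index = λ i → proj₁ (x∈ i)

  ∈Image⇒CardLe : ∀ {B} {H : Carrier → Set (c ⊔ ℓ)} (rep : Fin B → Carrier) →
                  (∀ {x} → H x → x ∈Image rep) → CardLe H B
  ∈Image⇒CardLe rep cover k x x∈H distinct = injective⇒≤ {f = index} λ {i} {j} index≡ →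
    distinct i j (trans (proj₂ (cover (x∈H i))) (trans (reflexive (≡.cong rep index≡)) (sym (proj₂ (cover (x∈H j))))))
    where index = λ i → proj₁ (cover (x∈H i))

  CardLe-mono : ∀ {H : Carrier → Set (c ⊔ ℓ)} {B B′} → CardLe H B → B ≤ B′ → CardLe H B′
  CardLe-mono H≤B B≤B′ k x x∈H distinct = ≤-trans (H≤B k x x∈H distinct) B≤B′

module Commutators {c ℓ : Level} (G : Group c ℓ) where
  open Group G
  open GroupTheory G

  ⁅⁆-cong : ∀ {a a′ b b′} → a ≈ a′ → b ≈ b′ → ⁅ a , b ⁆ ≈ ⁅ a′ , b′ ⁆
  ⁅⁆-cong a≈ b≈ = ∙-cong (∙-cong (∙-cong (⁻¹-cong a≈) (⁻¹-cong b≈)) a≈) b≈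

  ⁅⁆∈γ : ∀ {i a} b → γ (suc i) a → γ (suc (suc i)) ⁅ a , b ⁆
  ⁅⁆∈γ b a∈ = gen-base (_ , b , a∈ , refl)

  ⁅⁆∈γ₂ : ∀ a b → γ 2 ⁅ a , b ⁆
  ⁅⁆∈γ₂ a b = ⁅⁆∈γ {0} b _

module ClassAtMostThree {c ℓ : Level} (G : Group c ℓ) (γ₄-trivial : GroupTheory.Trivial G (GroupTheory.γ G 4)) where
  open Group G hiding (_-_)
  open GroupTheory G renaming (_^_ to _^ᵍ_)
  open Commutators G
  open GroupSolver G
  open import Algebra.Properties.Group G
    using (x≈y⇒x∙y⁻¹≈ε; inverseʳ-unique; inverseˡ-unique; ⁻¹-anti-homo-∙; ε⁻¹≈ε)
  open import Algebra.Properties.Monoid.Sum monoid using ()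
    renaming (sum to ∏; sum-cong-≋ to ∏-cong; sum-replicate-zero to ∏-replicate-ε)
  open import Relation.Binary.Reasoning.Setoid setoid

  γ₃-central : ∀ {z} → γ 3 z → ∀ g → z ∙ g ≈ g ∙ z
  γ₃-central {z} z∈ g = begin
    z ∙ g              ≈⟨ solve 2 (λ z g → z ⊕ g ⊜ g ⊕ z ⊕ ⁅ z , g ⁆ₑ) refl z g ⟩
    g ∙ z ∙ ⁅ z , g ⁆  ≈⟨ ∙-congˡ (γ₄-trivial _ (⁅⁆∈γ {2} g z∈)) ⟩
    g ∙ z ∙ ε          ≈⟨ identityʳ _ ⟩
    g ∙ z              ∎

  γ₃-central-middle : ∀ {z} → γ 3 z → ∀ x y → x ∙ (z ∙ y) ≈ z ∙ (x ∙ y)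
  γ₃-central-middle {z} z∈ x y = begin
    x ∙ (z ∙ y)  ≈⟨ assoc _ _ _ ⟨
    x ∙ z ∙ y    ≈⟨ ∙-congʳ (γ₃-central z∈ x) ⟨
    z ∙ x ∙ y    ≈⟨ assoc _ _ _ ⟩
    z ∙ (x ∙ y)  ∎

  γ₃-conjugate : ∀ {z} → γ 3 z → ∀ b → b ⁻¹ ∙ z ∙ b ≈ z
  γ₃-conjugate {z} z∈ b = begin
    b ⁻¹ ∙ z ∙ b    ≈⟨ assoc _ _ _ ⟩
    b ⁻¹ ∙ (z ∙ b)  ≈⟨ ∙-congˡ (γ₃-central z∈ b) ⟩
    b ⁻¹ ∙ (b ∙ z)  ≈⟨ solve 2 (λ b z → ⊝ b ⊕ (b ⊕ z) ⊜ z) refl b z ⟩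
    z               ∎

  infix 4 _~_
  _~_ : Carrier → Carrier → Set (c ⊔ ℓ)
  a ~ b = γ 3 (a ∙ b ⁻¹)

  ≈⇒~ : ∀ {a b} → a ≈ b → a ~ b
  ≈⇒~ a≈b = gen-≈ (sym (x≈y⇒x∙y⁻¹≈ε a≈b)) gen-ε

  ~-refl : ∀ {a} → a ~ a
  ~-refl = ≈⇒~ refl

  ~-sym : ∀ {a b} → a ~ b → b ~ a
  ~-sym {a} {b} a~b = gen-≈ (solve 2 (λ a b → ⊝ (a ⊕ ⊝ b) ⊜ b ⊕ ⊝ a) refl a b) (gen-⁻¹ a~b)

  ~-trans : ∀ {a b d} → a ~ b → b ~ d → a ~ d
  ~-trans {a} {b} {d} a~b b~d =
    gen-≈ (solve 3 (λ a b d → a ⊕ ⊝ b ⊕ (b ⊕ ⊝ d) ⊜ a ⊕ ⊝ d) refl a b d) (gen-∙ a~b b~d)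

  ~-∙ : ∀ {a a′ b b′} → a ~ a′ → b ~ b′ → a ∙ b ~ a′ ∙ b′
  ~-∙ {a} {a′} {b} {b′} a~a′ b~b′ = gen-≈ (begin
    a ∙ a′ ⁻¹ ∙ (b ∙ b′ ⁻¹)
      ≈⟨ assoc _ _ _ ⟩
    a ∙ (a′ ⁻¹ ∙ (b ∙ b′ ⁻¹))
      ≈⟨ ∙-congˡ (γ₃-central b~b′ _) ⟨
    a ∙ (b ∙ b′ ⁻¹ ∙ a′ ⁻¹)
      ≈⟨ solve 4 (λ a a′ b b′ → a ⊕ (b ⊕ ⊝ b′ ⊕ ⊝ a′) ⊜ a ⊕ b ⊕ ⊝ (a′ ⊕ b′)) refl a a′ b b′ ⟩
    a ∙ b ∙ (a′ ∙ b′) ⁻¹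
      ∎) (gen-∙ a~a′ b~b′)

  ~-⁻¹ : ∀ {a a′} → a ~ a′ → a ⁻¹ ~ a′ ⁻¹
  ~-⁻¹ {a} {a′} a~a′ = gen-≈ (begin
    a′ ∙ a ⁻¹
      ≈⟨ solve 2 (λ a a′ → a′ ⊕ ⊝ a ⊜ ⊝ a ⊕ (a ⊕ (a′ ⊕ ⊝ a))) refl a a′ ⟩
    a ⁻¹ ∙ (a ∙ (a′ ∙ a ⁻¹))
      ≈⟨ ∙-congˡ (γ₃-central (~-sym a~a′) a) ⟨
    a ⁻¹ ∙ (a′ ∙ a ⁻¹ ∙ a)
      ≈⟨ solve 2 (λ a a′ → ⊝ a ⊕ (a′ ⊕ ⊝ a ⊕ a) ⊜ ⊝ a ⊕ ⊝ ⊝ a′) refl a a′ ⟩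
    a ⁻¹ ∙ a′ ⁻¹ ⁻¹
      ∎) (~-sym a~a′)

  γ₂-comm : ∀ {a b} → γ 2 a → γ 2 b → a ∙ b ~ b ∙ a
  γ₂-comm {a} {b} a∈ b∈ = gen-≈ (solve 2 (λ a b → ⁅ ⊝ a , ⊝ b ⁆ₑ ⊜ a ⊕ b ⊕ ⊝ (b ⊕ a)) refl a b)
                                (⁅⁆∈γ {1} (b ⁻¹) (gen-⁻¹ a∈))

  γ₂-^ : ∀ {a} → γ 2 a → ∀ e → γ 2 (a ^ᵍ e)
  γ₂-^ a∈ zero    = gen-ε
  γ₂-^ a∈ (suc e) = gen-∙ a∈ (γ₂-^ a∈ e)

  ⁅⁆-εˡ : ∀ g → ⁅ ε , g ⁆ ≈ ε
  ⁅⁆-εˡ = solve 1 (λ g → ⁅ id , g ⁆ₑ ⊜ id) refl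

  ⁅⁆-εʳ : ∀ a → ⁅ a , ε ⁆ ≈ ε
  ⁅⁆-εʳ = solve 1 (λ a → ⁅ a , id ⁆ₑ ⊜ id) refl

  ⁅⁆-~ˡ : ∀ {a a′} → a ~ a′ → ∀ g → ⁅ a , g ⁆ ≈ ⁅ a′ , g ⁆
  ⁅⁆-~ˡ {a} {a′} a~a′ g = begin
    ⁅ a , g ⁆
      ≈⟨ solve 3 (λ a a′ g → ⁅ a , g ⁆ₑ ⊜ ⊝ a′ ⊕ ⁅ a ⊕ ⊝ a′ , g ⁆ₑ ⊕ (a′ ⊕ ⁅ a′ , g ⁆ₑ)) refl a a′ g ⟩
    a′ ⁻¹ ∙ ⁅ a ∙ a′ ⁻¹ , g ⁆ ∙ (a′ ∙ ⁅ a′ , g ⁆)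
      ≈⟨ ∙-congʳ (∙-congˡ (γ₄-trivial _ (⁅⁆∈γ {2} g a~a′))) ⟩
    a′ ⁻¹ ∙ ε ∙ (a′ ∙ ⁅ a′ , g ⁆)
      ≈⟨ solve 2 (λ a′ z → ⊝ a′ ⊕ id ⊕ (a′ ⊕ z) ⊜ z) refl a′ _ ⟩
    ⁅ a′ , g ⁆
      ∎

  module _ {a : Carrier} (a∈ : γ 2 a) where
    ⁅⁆-∙ʳ : ∀ g h → ⁅ a , g ∙ h ⁆ ≈ ⁅ a , g ⁆ ∙ ⁅ a , h ⁆
    ⁅⁆-∙ʳ g h = begin
      ⁅ a , g ∙ h ⁆
        ≈⟨ solve 3 (λ a g h → ⁅ a , g ⊕ h ⁆ₑ ⊜ ⊝ a ⊕ ⊝ h ⊕ a ⊕ (⁅ a , g ⁆ₑ ⊕ h)) refl a g h ⟩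
      a ⁻¹ ∙ h ⁻¹ ∙ a ∙ (⁅ a , g ⁆ ∙ h)
        ≈⟨ γ₃-central-middle (⁅⁆∈γ {1} g a∈) _ h ⟩
      ⁅ a , g ⁆ ∙ ⁅ a , h ⁆
        ∎

    ⁅⁆-∙ˡ : ∀ b g → ⁅ a ∙ b , g ⁆ ≈ ⁅ a , g ⁆ ∙ ⁅ b , g ⁆
    ⁅⁆-∙ˡ b g = begin
      ⁅ a ∙ b , g ⁆
        ≈⟨ solve 3 (λ a b g → ⁅ a ⊕ b , g ⁆ₑ ⊜ ⊝ b ⊕ (⁅ a , g ⁆ₑ ⊕ (⊝ g ⊕ b ⊕ g))) refl a b g ⟩
      b ⁻¹ ∙ (⁅ a , g ⁆ ∙ (g ⁻¹ ∙ b ∙ g))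
        ≈⟨ γ₃-central-middle (⁅⁆∈γ {1} g a∈) _ _ ⟩
      ⁅ a , g ⁆ ∙ (b ⁻¹ ∙ (g ⁻¹ ∙ b ∙ g))
        ≈⟨ solve 3 (λ z b g → z ⊕ (⊝ b ⊕ (⊝ g ⊕ b ⊕ g)) ⊜ z ⊕ ⁅ b , g ⁆ₑ) refl _ b g ⟩
      ⁅ a , g ⁆ ∙ ⁅ b , g ⁆
        ∎

    ⁅⁆-⁻¹ʳ : ∀ g → ⁅ a , g ⁻¹ ⁆ ≈ ⁅ a , g ⁆ ⁻¹
    ⁅⁆-⁻¹ʳ g = inverseʳ-unique _ _ (begin
      ⁅ a , g ⁆ ∙ ⁅ a , g ⁻¹ ⁆  ≈⟨ ⁅⁆-∙ʳ g (g ⁻¹) ⟨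
      ⁅ a , g ∙ g ⁻¹ ⁆          ≈⟨ ⁅⁆-cong refl (inverseʳ g) ⟩
      ⁅ a , ε ⁆                 ≈⟨ ⁅⁆-εʳ a ⟩
      ε                         ∎)

    ⁅⁆-^ : ∀ g e → ⁅ a ^ᵍ e , g ⁆ ≈ ⁅ a , g ^ᵍ e ⁆
    ⁅⁆-^ g zero    = trans (⁅⁆-εˡ g) (sym (⁅⁆-εʳ a))
    ⁅⁆-^ g (suc e) = begin
      ⁅ a ∙ a ^ᵍ e , g ⁆          ≈⟨ ⁅⁆-∙ˡ (a ^ᵍ e) g ⟩
      ⁅ a , g ⁆ ∙ ⁅ a ^ᵍ e , g ⁆  ≈⟨ ∙-congˡ (⁅⁆-^ g e) ⟩
      ⁅ a , g ⁆ ∙ ⁅ a , g ^ᵍ e ⁆  ≈⟨ ⁅⁆-∙ʳ g (g ^ᵍ e) ⟨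
      ⁅ a , g ∙ g ^ᵍ e ⁆          ∎

  -- The Hall–Witt identity, with its three conjugations dropped because γ 3 is central.
  hall-witt : ∀ x y g →
              ⁅ ⁅ x , y ⁆ , g ⁆ ≈ (⁅ ⁅ y ⁻¹ , g ⁻¹ ⁆ , x ⁆ ∙ ⁅ ⁅ g , x ⁻¹ ⁆ , y ⁻¹ ⁆) ⁻¹
  hall-witt x y g = inverseˡ-unique A (B ∙ C) (begin
    A ∙ (B ∙ C)
      ≈⟨ ∙-cong (γ₃-conjugate A∈ (y ⁻¹)) (∙-cong (γ₃-conjugate B∈ g) (γ₃-conjugate C∈ x)) ⟨
    y ⁻¹ ⁻¹ ∙ A ∙ y ⁻¹ ∙ (g ⁻¹ ∙ B ∙ g ∙ (x ⁻¹ ∙ C ∙ x))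
      ≈⟨ solve 3 (λ x y g → ⊝ ⊝ y ⊕ ⁅ ⁅ x , y ⁆ₑ , g ⁆ₑ ⊕ ⊝ y
                              ⊕ (⊝ g ⊕ ⁅ ⁅ ⊝ y , ⊝ g ⁆ₑ , x ⁆ₑ ⊕ g
                                 ⊕ (⊝ x ⊕ ⁅ ⁅ g , ⊝ x ⁆ₑ , ⊝ y ⁆ₑ ⊕ x))
                            ⊜ id) refl x y g ⟩
    ε ∎)
    where
    A = ⁅ ⁅ x , y ⁆ , g ⁆
    B = ⁅ ⁅ y ⁻¹ , g ⁻¹ ⁆ , x ⁆
    C = ⁅ ⁅ g , x ⁻¹ ⁆ , y ⁻¹ ⁆
    A∈ = ⁅⁆∈γ {1} g (⁅⁆∈γ₂ x y)
    B∈ = ⁅⁆∈γ {1} x (⁅⁆∈γ₂ (y ⁻¹) (g ⁻¹))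
    C∈ = ⁅⁆∈γ {1} (y ⁻¹) (⁅⁆∈γ₂ g (x ⁻¹))

  ⁅∏⁆ˡ : ∀ {k} {a : Fin k → Carrier} → (∀ i → γ 2 (a i)) →
         ∀ g → ⁅ ∏ a , g ⁆ ≈ ∏ (λ i → ⁅ a i , g ⁆)
  ⁅∏⁆ˡ {zero}  a∈ g = ⁅⁆-εˡ g
  ⁅∏⁆ˡ {suc k} a∈ g = trans (⁅⁆-∙ˡ (a∈ zero) _ g) (∙-congˡ (⁅∏⁆ˡ (a∈ ∘ suc) g))

  ∏-∙-γ₃ : ∀ {k} (a : Fin k → Carrier) {b : Fin k → Carrier} → (∀ i → γ 3 (b i)) →
           ∏ a ∙ ∏ b ≈ ∏ (λ i → a i ∙ b i)
  ∏-∙-γ₃ {zero}  a b∈ = identityʳ ε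
  ∏-∙-γ₃ {suc k} a {b} b∈ = begin
    a zero ∙ ∏ (a ∘ suc) ∙ (b zero ∙ ∏ (b ∘ suc))      ≈⟨ assoc _ _ _ ⟩
    a zero ∙ (∏ (a ∘ suc) ∙ (b zero ∙ ∏ (b ∘ suc)))    ≈⟨ ∙-congˡ (γ₃-central-middle (b∈ zero) _ _) ⟩
    a zero ∙ (b zero ∙ (∏ (a ∘ suc) ∙ ∏ (b ∘ suc)))    ≈⟨ assoc _ _ _ ⟨
    a zero ∙ b zero ∙ (∏ (a ∘ suc) ∙ ∏ (b ∘ suc))      ≈⟨ ∙-congˡ (∏-∙-γ₃ (a ∘ suc) (b∈ ∘ suc)) ⟩
    a zero ∙ b zero ∙ ∏ (λ i → a (suc i) ∙ b (suc i))  ∎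

  ∏-⁻¹-γ₃ : ∀ {k} {a : Fin k → Carrier} → (∀ i → γ 3 (a i)) → ∏ a ⁻¹ ≈ ∏ (λ i → a i ⁻¹)
  ∏-⁻¹-γ₃ {zero}  a∈ = ε⁻¹≈ε
  ∏-⁻¹-γ₃ {suc k} {a} a∈ = begin
    (a zero ∙ ∏ (a ∘ suc)) ⁻¹           ≈⟨ ⁻¹-anti-homo-∙ _ _ ⟩
    ∏ (a ∘ suc) ⁻¹ ∙ a zero ⁻¹          ≈⟨ γ₃-central (gen-⁻¹ (a∈ zero)) _ ⟨
    a zero ⁻¹ ∙ ∏ (a ∘ suc) ⁻¹          ≈⟨ ∙-congˡ (∏-⁻¹-γ₃ (a∈ ∘ suc)) ⟩
    a zero ⁻¹ ∙ ∏ (λ i → a (suc i) ⁻¹)  ∎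

  γ₃-decomposition : ∀ {k} {d : Fin k → Carrier} → (∀ i → γ 2 (d i)) →
                     (∀ {a} → γ 2 a → Σ[ e ∈ (Fin k → ℕ) ] a ~ ∏ (λ i → d i ^ᵍ e i)) →
                     ∀ {z} → γ 3 z → Σ[ g ∈ (Fin k → Carrier) ] z ≈ ∏ (λ i → ⁅ d i , g i ⁆)
  γ₃-decomposition {d = d} d∈ spans (gen-base (a , b , a∈ , z≈⁅a,b⁆)) with spans a∈
  ... | e , a~ = (λ i → b ^ᵍ e i) , (begin
    _                             ≈⟨ z≈⁅a,b⁆ ⟩
    ⁅ a , b ⁆                     ≈⟨ ⁅⁆-~ˡ a~ b ⟩
    ⁅ ∏ (λ i → d i ^ᵍ e i) , b ⁆  ≈⟨ ⁅∏⁆ˡ (λ i → γ₂-^ (d∈ i) (e i)) b ⟩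
    ∏ (λ i → ⁅ d i ^ᵍ e i , b ⁆)  ≈⟨ ∏-cong (λ i → ⁅⁆-^ (d∈ i) b (e i)) ⟩
    ∏ (λ i → ⁅ d i , b ^ᵍ e i ⁆)  ∎)
  γ₃-decomposition {k} {d} d∈ spans gen-ε = (λ _ → ε) , (begin
    ε                      ≈⟨ ∏-replicate-ε k ⟨
    ∏ {k} (λ _ → ε)        ≈⟨ ∏-cong (λ i → ⁅⁆-εʳ (d i)) ⟨
    ∏ (λ i → ⁅ d i , ε ⁆)  ∎)
  γ₃-decomposition {d = d} d∈ spans (gen-∙ z∈ z′∈)
    with (g , z≈) ← γ₃-decomposition d∈ spans z∈ | (g′ , z′≈) ← γ₃-decomposition d∈ spans z′∈ =
    (λ i → g i ∙ g′ i) , (begin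
    _
      ≈⟨ ∙-cong z≈ z′≈ ⟩
    ∏ (λ i → ⁅ d i , g i ⁆) ∙ ∏ (λ i → ⁅ d i , g′ i ⁆)
      ≈⟨ ∏-∙-γ₃ _ (λ i → ⁅⁆∈γ {1} (g′ i) (d∈ i)) ⟩
    ∏ (λ i → ⁅ d i , g i ⁆ ∙ ⁅ d i , g′ i ⁆)
      ≈⟨ ∏-cong (λ i → ⁅⁆-∙ʳ (d∈ i) (g i) (g′ i)) ⟨
    ∏ (λ i → ⁅ d i , g i ∙ g′ i ⁆)
      ∎)
  γ₃-decomposition {d = d} d∈ spans (gen-⁻¹ z∈) with (g , z≈) ← γ₃-decomposition d∈ spans z∈ =
    (λ i → g i ⁻¹) , (begin
    _                           ≈⟨ ⁻¹-cong z≈ ⟩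
    ∏ (λ i → ⁅ d i , g i ⁆) ⁻¹  ≈⟨ ∏-⁻¹-γ₃ (λ i → ⁅⁆∈γ {1} (g i) (d∈ i)) ⟩
    ∏ (λ i → ⁅ d i , g i ⁆ ⁻¹)  ≈⟨ ∏-cong (λ i → ⁅⁆-⁻¹ʳ (d∈ i) (g i)) ⟨
    ∏ (λ i → ⁅ d i , g i ⁻¹ ⁆)  ∎)
  γ₃-decomposition d∈ spans (gen-≈ z≈z′ z∈) with (g , z≈) ← γ₃-decomposition d∈ spans z∈ =
    g , trans (sym z≈z′) z≈

  -- Fin n, with the operations transported along the transversal f, models γ 2 / γ 3.
  module CentralQuotient {n : ℕ} (f : Fin n → Carrier) (f∈γ₂ : ∀ i → γ 2 (f i))
    (f-injective : ∀ i j → f i ~ f j → i ≡ j) (f-surjective : ∀ a → γ 2 a → ∃[ i ] a ~ f i) where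

    open Images G
    open import Data.Fin using (remQuot; finToFun)

    class : ∀ {a} → γ 2 a → Fin n
    class {a} a∈ = proj₁ (f-surjective a a∈)

    ~f-class : ∀ {a} (a∈ : γ 2 a) → a ~ f (class a∈)
    ~f-class {a} a∈ = proj₂ (f-surjective a a∈)

    class-unique : ∀ {a q r} → a ~ f q → a ~ f r → q ≡ r
    class-unique a~q a~r = f-injective _ _ (~-trans (~-sym a~q) a~r)

    infixl 6 _+_
    infix  8 -_

    _+_ : Op₂ (Fin n)
    q + r = class (gen-∙ (f∈γ₂ q) (f∈γ₂ r))

    0# : Fin n
    0# = class gen-ε

    -_ : Op₁ (Fin n)
    - q = class (gen-⁻¹ (f∈γ₂ q))

    ~-+ : ∀ {a b q r} → a ~ f q → b ~ f r → a ∙ b ~ f (q + r)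
    ~-+ a~ b~ = ~-trans (~-∙ a~ b~) (~f-class _)

    ~-0# : ε ~ f 0#
    ~-0# = ~f-class gen-ε

    ~-neg : ∀ {a q} → a ~ f q → a ⁻¹ ~ f (- q)
    ~-neg a~ = ~-trans (~-⁻¹ a~) (~f-class _)

    +-isAbelianGroup : IsAbelianGroup _≡_ _+_ 0# -_
    +-isAbelianGroup = record
      { isGroup = record
        { isMonoid = record
          { isSemigroup = record
            { isMagma = record { isEquivalence = ≡.isEquivalence ; ∙-cong = ≡.cong₂ _+_ }
            ; assoc   = λ q r s → class-unique (~-+ (~-+ ~-refl ~-refl) ~-refl)
                                               (~-trans (≈⇒~ (assoc _ _ _)) (~-+ ~-refl (~-+ ~-refl ~-refl)))
            }
          ; identity = (λ q → class-unique (~-+ ~-0# ~-refl) (≈⇒~ (identityˡ _)))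
                     , (λ q → class-unique (~-+ ~-refl ~-0#) (≈⇒~ (identityʳ _)))
          }
        ; inverse = (λ q → class-unique (~-+ (~-neg ~-refl) ~-refl) (~-trans (≈⇒~ (inverseˡ _)) ~-0#))
                  , (λ q → class-unique (~-+ ~-refl (~-neg ~-refl)) (~-trans (≈⇒~ (inverseʳ _)) ~-0#))
        ; ⁻¹-cong = ≡.cong -_
        }
      ; comm = λ q r → class-unique (~-+ ~-refl ~-refl) (~-trans (γ₂-comm (f∈γ₂ q) (f∈γ₂ r)) (~-+ ~-refl ~-refl))
      }

    open FiniteAbelianGroup +-isAbelianGroup
      using (_·_; sum; _Annihilates_; InSpan; Generated; gen-base; gen-0#; gen-+; gen-neg; module PGroup)

    ~-· : ∀ {a q} → a ~ f q → ∀ e → a ^ᵍ e ~ f (e · q)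
    ~-· a~ zero    = ~-0#
    ~-· a~ (suc e) = ~-+ a~ (~-· a~ e)

    ~-∑ : ∀ {k} {a : Fin k → Carrier} {q : Fin k → Fin n} → (∀ i → a i ~ f (q i)) → ∏ a ~ f (sum q)
    ~-∑ {zero}  a~ = ~-0#
    ~-∑ {suc k} a~ = ~-+ (a~ zero) (~-∑ (a~ ∘ suc))

    p-torsion : ∀ {p} → IsPGroup p → ∀ q → ∃[ s ] (p ^ s) Annihilates q
    p-torsion {p} p-group q with p-group (f q)
    ... | s , f[q]^p^s≈ε = s , class-unique (~-· ~-refl (p ^ s)) (~-trans (≈⇒~ f[q]^p^s≈ε) ~-0#)

    IsCommutatorClass : Fin n → Set (c ⊔ ℓ)
    IsCommutatorClass q = ∃[ x ] ∃[ y ] ⁅ x , y ⁆ ~ f q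

    class-generated : ∀ {a} (a∈ : γ 2 a) → Generated IsCommutatorClass (class a∈)
    class-generated (gen-base (x , y , _ , a≈)) = gen-base (x , y , ~-trans (≈⇒~ (sym a≈)) (~f-class _))
    class-generated gen-ε                       = gen-0#
    class-generated (gen-∙ a∈ b∈)               = ≡.subst (Generated _)
      (class-unique (~-+ (~f-class a∈) (~f-class b∈)) (~f-class _)) (gen-+ (class-generated a∈) (class-generated b∈))
    class-generated (gen-⁻¹ a∈)                 = ≡.subst (Generated _)
      (class-unique (~-neg (~f-class a∈)) (~f-class _)) (gen-neg (class-generated a∈))
    class-generated (gen-≈ a≈b a∈)              = ≡.subst (Generated _)
      (class-unique (~-trans (≈⇒~ (sym a≈b)) (~f-class a∈)) (~f-class _)) (class-generated a∈)

    commutator-classes-generate : ∀ q → Generated IsCommutatorClass q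
    commutator-classes-generate q =
      ≡.subst (Generated _) (class-unique (~f-class (f∈γ₂ q)) ~-refl) (class-generated (f∈γ₂ q))

    hall-witt-rep : Carrier → Carrier → Fin n × Fin n → Carrier
    hall-witt-rep x y (q₁ , q₂) = (⁅ f q₁ , x ⁆ ∙ ⁅ f q₂ , y ⁻¹ ⁆) ⁻¹

    ⁅⁅⁆⁆∈Image : ∀ x y g → ⁅ ⁅ x , y ⁆ , g ⁆ ∈Image hall-witt-rep x y
    ⁅⁅⁆⁆∈Image x y g = (class (⁅⁆∈γ₂ (y ⁻¹) (g ⁻¹)) , class (⁅⁆∈γ₂ g (x ⁻¹))) ,
      trans (hall-witt x y g) (⁻¹-cong (∙-cong (⁅⁆-~ˡ (~f-class _) x) (⁅⁆-~ˡ (~f-class _) (y ⁻¹))))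

    module _ {k : ℕ} {c : Fin k → Fin n} (c-commutator : ∀ i → IsCommutatorClass (c i))
             (spans : ∀ q → InSpan c q) where

      x y : Fin k → Carrier
      x i = proj₁ (c-commutator i)
      y i = proj₁ (proj₂ (c-commutator i))

      ⁅x,y⁆~c : ∀ i → ⁅ x i , y i ⁆ ~ f (c i)
      ⁅x,y⁆~c i = proj₂ (proj₂ (c-commutator i))

      ∏⁅x,y⁆^~ : ∀ (e : Fin k → ℕ) → ∏ (λ i → ⁅ x i , y i ⁆ ^ᵍ e i) ~ f (sum (λ i → e i · c i))
      ∏⁅x,y⁆^~ e = ~-∑ λ i → ~-· (⁅x,y⁆~c i) (e i)

      γ₂-spanned : ∀ {a} → γ 2 a → Σ[ e ∈ (Fin k → ℕ) ] a ~ ∏ (λ i → ⁅ x i , y i ⁆ ^ᵍ e i)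
      γ₂-spanned a∈ with spans (class a∈)
      ... | e , class≡∑ = e , ~-trans (~f-class a∈) (~-sym (≡.subst (λ q → _ ~ f q) (≡.sym class≡∑) (∏⁅x,y⁆^~ e)))

      γ₃-rep : Fin ((n * n) ^ k) → Carrier
      γ₃-rep j = ∏ (λ i → hall-witt-rep (x i) (y i) (remQuot n (finToFun j i)))

      γ₃⊆Image : ∀ {z} → γ 3 z → z ∈Image γ₃-rep
      γ₃⊆Image z∈ with (g , z≈) ← γ₃-decomposition (λ i → ⁅⁆∈γ₂ (x i) (y i)) γ₂-spanned z∈ =
        ∈Image-resp-≈ z≈ (∈Image-∏ λ i → ∈Image-pair (⁅⁅⁆⁆∈Image (x i) (y i) (g i)))

      γ₂-rep : Fin ((n * n) ^ k) × Fin n → Carrier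
      γ₂-rep (j , q) = γ₃-rep j ∙ f q

      γ₂⊆Image : ∀ {a} → γ 2 a → a ∈Image γ₂-rep
      γ₂⊆Image {a} a∈ = (j , class a∈) , (begin
        a                                   ≈⟨ solve 2 (λ a b → a ⊜ a ⊕ ⊝ b ⊕ b) refl a (f (class a∈)) ⟩
        a ∙ f (class a∈) ⁻¹ ∙ f (class a∈)  ≈⟨ ∙-congʳ (proj₂ j∈) ⟩
        γ₃-rep j ∙ f (class a∈)             ∎)
        where
        j∈ = γ₃⊆Image (~f-class a∈)
        j  = proj₁ j∈

    γ₃-γ₂-CardLe : ∀ {p} → Prime p → IsPGroup p →
                   ∃[ k ] p ^ k ≤ n × CardLe (γ 3) ((n * n) ^ k) × CardLe (γ 2) ((n * n) ^ k * n)
    γ₃-γ₂-CardLe p-prime p-group =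
      let (k , p^k≤n , c , c-commutator , spans) =
            PGroup.small-spanning-family p-prime (p-torsion p-group) commutator-classes-generate
      in k , p^k≤n , ∈Image⇒CardLe _ (γ₃⊆Image c-commutator spans)
           , ∈Image⇒CardLe _ (∈Image-pair {rep = γ₂-rep c-commutator spans} ∘ γ₂⊆Image c-commutator spans)

lemma2p4 : ∀ {c ℓ : Level} (G : Group c ℓ) (p : ℕ) (m : ℕ) → Prime p →
    GroupTheory.IsPGroup G p →
    GroupTheory.NilpotentOfClass G 3 →
    GroupTheory.QuotientCard G (GroupTheory.γ G 2) (GroupTheory.γ G 3) (p ^ m) →
    GroupTheory.CardLe G (GroupTheory.γ G 3) (p ^ (2 * (m ^ 3)))
      × (∃[ N ] GroupTheory.CardLe G (GroupTheory.γ G 2) N)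
lemma2p4 G p m p-prime p-group (γ₄-trivial , _) (f , f∈γ₂ , f-injective , f-surjective) =
  let open ClassAtMostThree G γ₄-trivial
      open CentralQuotient f f∈γ₂ f-injective f-surjective
      open Images G
      (k , p^k≤p^m , γ₃≤ , γ₂≤) = γ₃-γ₂-CardLe p-prime p-group
  in  CardLe-mono {H = GroupTheory.γ G 3} γ₃≤ (^-square-bound {p} {m} {k} (prime⇒1<p p-prime) p^k≤p^m)
    , (_ , γ₂≤)
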